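{- For every $\lambda$-term $M$, $\{L_r(a)\mid a\in T_r(M),\ L_r(a)\neq0\}=T_r(L(M))$.
   Context: Rigid resource terms: $a ::= x\mid \lambda x.a\mid \langle c\rangle\vec d\mid 0$, $\vec d=(d_1,\dots,d_n)$ a finite list of rigid terms; up to $\alpha$; $0$ absorbing. Rigid substitution $a[\vec b/x]$, $\vec b=(b_1,\dots,b_k)$: if $x$ has exactly $k$ free occurrences in $a$, replace the $i$-th (left-to-right) by $b_i$; else $0$. $\to_r$: contextual closure of $\langle\lambda x.a\rangle\vec b\to_r a[\vec b/x]$. Rigid expansion: $T_r(x)=\{x\}$, $T_r(\lambda x.M)=\{\lambda x.a\mid a\in T_r(M)\}$, $T_r(PQ)=\{\langle c\rangle(d_1,\dots,d_n)\mid c\in T_r(P), n\ge0, d_i\in T_r(Q)\}$. Left-parallel reduction: $L(M)=M$ if $M$ is $\beta$-normal; $L(\lambda\vec x.yQ_1\dots Q_n)=\lambda\vec x.yL(Q_1)\dots L(Q_n)$ for $y$ a variable and $M$ not $\beta$-normal; $L(\lambda\vec x.(\lambda x.P)QQ_1\dots Q_n)=\lambda\vec x.P[Q/x]Q_1\dots Q_n$. Rigid version: $L_r(a)=a$ if $a$ is $\to_r$-normal (including $0$); $L_r(\lambda\vec x.\langle\cdots\langle y\rangle\vec d_1\cdots\rangle\vec d_n)=\lambda\vec x.\langle\cdots\langle y\rangle L_r(\vec d_1)\cdots\rangle L_r(\vec d_n)$ otherwise ($y$ a variable, $L_r$ componentwise on lists); $L_r(\lambda\vec x.\langle\cdots\langle\langle\lambda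 x.c\rangle\vec d\rangle\vec d_1\cdots\rangle\vec d_n)=\lambda\vec x.\langle\cdots\langle c[\vec d/x]\rangle\vec d_1\cdots\rangle\vec d_n$. -}

module Defs where

open import Data.Nat using (ℕ; zero; suc; pred; _<?_; _≡ᵇ_; _+_)
open import Data.Nat.Properties using (<-cmp)
open import Data.Bool using (Bool; true; false; if_then_else_; _∧_)
open import Data.List using (List; []; _∷_; length)
open import Data.List.Relation.Unary.All using (All)
open import Data.Maybe using (Maybe; just; nothing; _>>=_)
import Data.Maybe as Maybe
open import Data.Product using (_×_; _,_; proj₁)
open import Relation.Binary.Definitions using (tri<; tri≈; tri>)
open import Relation.Nullary using (yes; no)

data Λ : Set where
  var : ℕ → Λ
  lam : Λ → Λ
  app : Λ → Λ → Λ

shift : ℕ → Λ → Λ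
shift c (var x) with x <? c
... | yes _ = var x
... | no  _ = var (suc x)
shift c (lam M)   = lam (shift (suc c) M)
shift c (app M N) = app (shift c M) (shift c N)

shiftN : ℕ → Λ → Λ
shiftN zero    M = M
shiftN (suc n) M = shift 0 (shiftN n M)

-- capture-avoiding substitution of N for index k (the binder being removed)
subst : ℕ → Λ → Λ → Λ
subst k (var x) N with <-cmp x k
... | tri< _ _ _ = var x
... | tri≈ _ _ _ = shiftN k N
... | tri> _ _ _ = var (pred x)
subst k (lam M)    N = lam (subst (suc k) M N)
subst k (app M M') N = app (subst k M N) (subst k M' N)

-- P [ Q ] : body P of λx.P with x := Q
_[_] : Λ → Λ → Λ
P [ Q ] = subst 0 P Q

isNormal : Λ → Bool
isNormal (var x)         = true
isNormal (lam M)         = isNormal M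
isNormal (app (lam _) _) = false
isNormal (app M N)       = isNormal M ∧ isNormal N

headVar : Λ → Bool
headVar (var _)   = true
headVar (lam _)   = false
headVar (app M _) = headVar M

mutual
  L : Λ → Λ
  L M = if isNormal M then M else L₀ M

  L₀ : Λ → Λ
  L₀ (var x)               = var x
  L₀ (lam M)               = lam (L₀ M)
  L₀ (app (lam P) Q)       = P [ Q ]
  L₀ (app M N)             =
    if headVar M then app (argsL M) (L N) else app (L₀ M) N

  argsL : Λ → Λ
  argsL (app M N) = app (argsL M) (L N)
  argsL M         = M

-- Rigid resource terms (de Bruijn).  The absorbing term 0 is
-- represented by `nothing` in `Maybe RT`; RT itself contains no 0
-- (by absorption, any term with a 0 subterm is 0).

data RT : Set where
  rvar : ℕ → RT
  rlam : RT → RT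
  rapp : RT → List RT → RT

mutual
  rshift : ℕ → RT → RT
  rshift c (rvar x) with x <? c
  ... | yes _ = rvar x
  ... | no  _ = rvar (suc x)
  rshift c (rlam a)    = rlam (rshift (suc c) a)
  rshift c (rapp a ds) = rapp (rshift c a) (rshifts c ds)

  rshifts : ℕ → List RT → List RT
  rshifts c []       = []
  rshifts c (d ∷ ds) = rshift c d ∷ rshifts c ds

rshiftN : ℕ → RT → RT
rshiftN zero    a = a
rshiftN (suc n) a = rshift 0 (rshiftN n a)

mutual
  occ : ℕ → RT → ℕ
  occ k (rvar x)    = if x ≡ᵇ k then 1 else 0
  occ k (rlam a)    = occ (suc k) a
  occ k (rapp a ds) = occ k a + occs k ds

  occs : ℕ → List RT → ℕ
  occs k []       = 0
  occs k (d ∷ ds) = occ k d + occs k ds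

-- replace the occurrences of index k, left to right, by the successive
-- elements of the list; returns the unused rest of the list
mutual
  rsub : ℕ → RT → List RT → Maybe (RT × List RT)
  rsub k (rvar x) bs with <-cmp x k
  ... | tri< _ _ _ = just (rvar x , bs)
  rsub k (rvar x) []       | tri≈ _ _ _ = nothing
  rsub k (rvar x) (b ∷ bs) | tri≈ _ _ _ = just (rshiftN k b , bs)
  ... | tri> _ _ _ = just (rvar (pred x) , bs)
  rsub k (rlam a) bs =
    rsub (suc k) a bs >>= λ { (a' , bs') → just (rlam a' , bs') }
  rsub k (rapp a ds) bs =
    rsub k a bs >>= λ { (a' , bs1) →
    rsubs k ds bs1 >>= λ { (ds' , bs2) → just (rapp a' ds' , bs2) } }

  rsubs : ℕ → List RT → List RT → Maybe (List RT × List RT)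
  rsubs k [] bs = just ([] , bs)
  rsubs k (d ∷ ds) bs =
    rsub k d bs >>= λ { (d' , bs1) →
    rsubs k ds bs1 >>= λ { (ds' , bs2) → just (d' ∷ ds' , bs2) } }

-- rigid substitution c[b⃗/x] for the body c of λx.c (nothing = 0)
rsubst : RT → List RT → Maybe RT
rsubst c bs =
  if occ 0 c ≡ᵇ length bs then Maybe.map proj₁ (rsub 0 c bs) else nothing

mutual
  isNormalR : RT → Bool
  isNormalR (rvar _)          = true
  isNormalR (rlam a)          = isNormalR a
  isNormalR (rapp (rlam _) _) = false
  isNormalR (rapp c ds)       = isNormalR c ∧ allNormalR ds

  allNormalR : List RT → Bool
  allNormalR []       = true
  allNormalR (d ∷ ds) = isNormalR d ∧ allNormalR ds

headVarR : RT → Bool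
headVarR (rvar _)   = true
headVarR (rlam _)   = false
headVarR (rapp c _) = headVarR c

-- rigid left-parallel reduction L_r (on non-zero terms; L_r(0) = 0)
mutual
  Lr : RT → Maybe RT
  Lr a = if isNormalR a then just a else Lr₀ a

  Lr₀ : RT → Maybe RT
  Lr₀ (rvar x)           = just (rvar x)
  Lr₀ (rlam a)           = Maybe.map rlam (Lr₀ a)
  Lr₀ (rapp (rlam c) ds) = rsubst c ds
  Lr₀ (rapp c ds)        =
    if headVarR c
    then (argsLr c >>= λ c' → Lrs ds >>= λ ds' → just (rapp c' ds'))
    else (Lr₀ c >>= λ c' → just (rapp c' ds))

  argsLr : RT → Maybe RT
  argsLr (rapp c ds) = argsLr c >>= λ c' → Lrs ds >>= λ ds' → just (rapp c' ds')
  argsLr a           = just a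

  Lrs : List RT → Maybe (List RT)
  Lrs []       = just []
  Lrs (d ∷ ds) = Lr d >>= λ d' → Lrs ds >>= λ ds' → just (d' ∷ ds')

-- Rigid Taylor expansion, as a membership predicate: a ∈T M  iff a ∈ T_r(M)

data _∈T_ : RT → Λ → Set where
  var : ∀ {x} → rvar x ∈T var x
  lam : ∀ {a M} → a ∈T M → rlam a ∈T lam M
  app : ∀ {c ds P Q} → c ∈T P → All (_∈T Q) ds → rapp c ds ∈T app P Q

module Submission where

-- L and L_r are defined by the same case split on the shape of the term
-- (normal / variable-headed spine / head redex / otherwise), so the two
-- inclusions are proved by simultaneous structural induction, once three
-- facts make the two case splits line up:
--  * on normal terms the non-normal branches L₀ and Lr₀ are the identity,
--    so the normality test can be dropped: L = L₀ and L_r = Lr₀;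
--  * an approximant a ∈ T_r(M) has a variable head iff M has one;
--  * the substitution lemma: T_r(P[Q/x]) consists exactly of the non-zero
--    p[b⃗/x] with p ∈ T_r(P) and every bᵢ ∈ T_r(Q).  It is proved for
--    substitution under k binders, using that shifting commutes with T_r
--    and that generalised rigid substitution hands unused arguments back.

open import Defs
open import Data.Bool using (true; false; if_then_else_)
open import Data.Bool.Properties using (∧-conicalˡ; ∧-conicalʳ)
open import Data.Empty using (⊥-elim)
open import Data.List using (List; []; _∷_; length; _++_)
open import Data.List.Properties using (++-assoc; length-++; ++-identityʳ)
open import Data.List.Relation.Unary.All using (All; []; _∷_)
open import Data.List.Relation.Unary.All.Properties using (++⁺)
open import Data.Maybe using (Maybe; just; _>>=_)
import Data.Maybe as Maybe
open import Data.Nat using (ℕ; zero; suc; _≡ᵇ_; _+_; _<?_)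
open import Data.Nat.Properties using (<-cmp)
open import Data.Product using (∃; _×_; _,_; proj₁)
open import Function.Bundles using (_⇔_; mk⇔)
open import Relation.Binary.Definitions using (tri<; tri≈; tri>)
open import Relation.Binary.PropositionalEquality
  using (_≡_; refl; sym; trans; cong; cong₂)
import Relation.Binary.PropositionalEquality as Eq
open import Relation.Nullary using (yes; no; ¬_)

-- Inversion of successful Maybe computations: the absorbing term 0 is
-- `nothing`, so a non-zero result forces every intermediate step to succeed.

>>=-just-inv : ∀ {A B : Set} (m : Maybe A) (f : A → Maybe B) {b : B} →
  (m >>= f) ≡ just b → ∃ λ a → m ≡ just a × f a ≡ just b
>>=-just-inv (just a) f e = a , refl , e

map-just-inv : ∀ {A B : Set} (f : A → B) (m : Maybe A) {b : B} →
  Maybe.map f m ≡ just b → ∃ λ a → m ≡ just a × f a ≡ b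
map-just-inv f (just a) refl = a , refl , refl

>>=₂-just : ∀ {A B C : Set} (f : A → B → C) {m : Maybe A} {x : A} {n : Maybe B} {y : B} →
  m ≡ just x → n ≡ just y → (m >>= λ u → n >>= λ v → just (f u v)) ≡ just (f x y)
>>=₂-just f refl refl = refl

if-true : ∀ {A : Set} {c} {x y : A} → c ≡ true → (if c then x else y) ≡ x
if-true refl = refl

if-false : ∀ {A : Set} {c} {x y : A} → c ≡ false → (if c then x else y) ≡ y
if-false refl = refl

≡ᵇ-refl : ∀ x → (x ≡ᵇ x) ≡ true
≡ᵇ-refl zero    = refl
≡ᵇ-refl (suc x) = ≡ᵇ-refl x

≢⇒≡ᵇ-false : ∀ x k → ¬ x ≡ k → (x ≡ᵇ k) ≡ false
≢⇒≡ᵇ-false zero    zero    x≢k = ⊥-elim (x≢k refl)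
≢⇒≡ᵇ-false zero    (suc k) x≢k = refl
≢⇒≡ᵇ-false (suc x) zero    x≢k = refl
≢⇒≡ᵇ-false (suc x) (suc k) x≢k = ≢⇒≡ᵇ-false x k (λ e → x≢k (cong suc e))

-- On →r-normal rigid terms every branch of L_r is the identity; hence the
-- normality test in L_r is redundant and L_r = Lr₀.
mutual
  Lr-normal : ∀ a → isNormalR a ≡ true → Lr a ≡ just a
  Lr-normal a nf rewrite nf = refl

  Lrs-normal : ∀ ds → allNormalR ds ≡ true → Lrs ds ≡ just ds
  Lrs-normal []       nf = refl
  Lrs-normal (d ∷ ds) nf
    rewrite Lr-normal d (∧-conicalˡ _ _ nf)
          | Lrs-normal ds (∧-conicalʳ (isNormalR d) _ nf) = refl

  argsLr-normal : ∀ a → isNormalR a ≡ true → argsLr a ≡ just a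
  argsLr-normal (rvar x)               nf = refl
  argsLr-normal (rlam a)               nf = refl
  argsLr-normal (rapp (rlam c) ds)     ()
  argsLr-normal (rapp (rvar x) ds)     nf rewrite Lrs-normal ds nf = refl
  argsLr-normal (rapp (rapp c ds₁) ds) nf
    rewrite argsLr-normal (rapp c ds₁) (∧-conicalˡ _ _ nf)
          | Lrs-normal ds (∧-conicalʳ (isNormalR (rapp c ds₁)) _ nf) = refl

  Lr₀-normal : ∀ a → isNormalR a ≡ true → Lr₀ a ≡ just a
  Lr₀-normal (rvar x)               nf = refl
  Lr₀-normal (rlam a)               nf rewrite Lr₀-normal a nf = refl
  Lr₀-normal (rapp (rlam c) ds)     ()
  Lr₀-normal (rapp (rvar x) ds)     nf rewrite Lrs-normal ds nf = refl
  Lr₀-normal (rapp (rapp c ds₁) ds) nf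
    with headVarR c | Lr₀-normal (rapp c ds₁) (∧-conicalˡ _ _ nf)
  ... | true  | _
    rewrite argsLr-normal (rapp c ds₁) (∧-conicalˡ _ _ nf)
          | Lrs-normal ds (∧-conicalʳ (isNormalR (rapp c ds₁)) _ nf) = refl
  ... | false | ih rewrite ih = refl

Lr≡Lr₀ : ∀ a → Lr a ≡ Lr₀ a
Lr≡Lr₀ a with isNormalR a in nf
... | true  = sym (Lr₀-normal a nf)
... | false = refl

mutual
  L-normal : ∀ M → isNormal M ≡ true → L M ≡ M
  L-normal M nf rewrite nf = refl

  argsL-normal : ∀ M → isNormal M ≡ true → argsL M ≡ M
  argsL-normal (var x)             nf = refl
  argsL-normal (lam M)             nf = refl
  argsL-normal (app (lam M) N)     ()
  argsL-normal (app (var x) N)     nf rewrite L-normal N nf = refl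
  argsL-normal (app (app M₁ M₂) N) nf
    rewrite argsL-normal (app M₁ M₂) (∧-conicalˡ _ _ nf)
          | L-normal N (∧-conicalʳ (isNormal (app M₁ M₂)) _ nf) = refl

  L₀-normal : ∀ M → isNormal M ≡ true → L₀ M ≡ M
  L₀-normal (var x)             nf = refl
  L₀-normal (lam M)             nf rewrite L₀-normal M nf = refl
  L₀-normal (app (lam M) N)     ()
  L₀-normal (app (var x) N)     nf rewrite L-normal N nf = refl
  L₀-normal (app (app M₁ M₂) N) nf
    with headVar M₁ | L₀-normal (app M₁ M₂) (∧-conicalˡ _ _ nf)
  ... | true  | _
    rewrite argsL-normal (app M₁ M₂) (∧-conicalˡ _ _ nf)
          | L-normal N (∧-conicalʳ (isNormal (app M₁ M₂)) _ nf) = refl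
  ... | false | ih rewrite ih = refl

L≡L₀ : ∀ M → L M ≡ L₀ M
L≡L₀ M with isNormal M in nf
... | true  = sym (L₀-normal M nf)
... | false = refl

-- An approximant has a variable head exactly when its λ-term does, so L
-- and L_r choose the same branch on a spine.
headVar-∈T : ∀ {c M} → c ∈T M → headVarR c ≡ headVar M
headVar-∈T var        = refl
headVar-∈T (lam d)    = refl
headVar-∈T (app d ds) = headVar-∈T d

mutual
  shift-∈T : ∀ {b Q} c → b ∈T Q → rshift c b ∈T shift c Q
  shift-∈T c (var {x}) with x <? c
  ... | yes _ = var
  ... | no  _ = var
  shift-∈T c (lam d)    = lam (shift-∈T (suc c) d)
  shift-∈T c (app d ds) = app (shift-∈T c d) (shifts-∈T c ds)

  shifts-∈T : ∀ {bs Q} c → All (_∈T Q) bs → All (_∈T shift c Q) (rshifts c bs)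
  shifts-∈T c []       = []
  shifts-∈T c (d ∷ ds) = shift-∈T c d ∷ shifts-∈T c ds

shiftN-∈T : ∀ {b Q} k → b ∈T Q → rshiftN k b ∈T shiftN k Q
shiftN-∈T zero    d = d
shiftN-∈T (suc k) d = shift-∈T 0 (shiftN-∈T k d)

shift-var-∈T : ∀ c x {b} → b ∈T shift c (var x) → rshift c (rvar x) ≡ b
shift-var-∈T c x d with x <? c
shift-var-∈T c x var | yes _ = refl
shift-var-∈T c x var | no  _ = refl

mutual
  shift-∈T-inv : ∀ c Q {b} → b ∈T shift c Q → ∃ λ q → q ∈T Q × rshift c q ≡ b
  shift-∈T-inv c (var x)   d = rvar x , var , shift-var-∈T c x d
  shift-∈T-inv c (lam Q)   (lam d) with shift-∈T-inv (suc c) Q d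
  ... | q , dq , refl = rlam q , lam dq , refl
  shift-∈T-inv c (app P Q) (app d ds) with shift-∈T-inv c P d | shifts-∈T-inv c Q ds
  ... | q , dq , refl | qs , dqs , refl = rapp q qs , app dq dqs , refl

  shifts-∈T-inv : ∀ c Q {bs} → All (_∈T shift c Q) bs →
    ∃ λ qs → All (_∈T Q) qs × rshifts c qs ≡ bs
  shifts-∈T-inv c Q []       = [] , [] , refl
  shifts-∈T-inv c Q (d ∷ ds) with shift-∈T-inv c Q d | shifts-∈T-inv c Q ds
  ... | q , dq , refl | qs , dqs , refl = q ∷ qs , dq ∷ dqs , refl

shiftN-∈T-inv : ∀ k Q {b} → b ∈T shiftN k Q → ∃ λ q → q ∈T Q × rshiftN k q ≡ b
shiftN-∈T-inv zero    Q d = _ , d , refl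
shiftN-∈T-inv (suc k) Q d with shift-∈T-inv 0 (shiftN k Q) d
... | q′ , dq′ , refl with shiftN-∈T-inv k Q dq′
...   | q , dq , refl = q , dq , refl

mutual
  rsub-sound : ∀ k {p P Q bs b rest} → p ∈T P → All (_∈T Q) bs →
    rsub k p bs ≡ just (b , rest) → b ∈T subst k P Q × All (_∈T Q) rest
  rsub-sound k (var {x}) dbs e with <-cmp x k
  rsub-sound k (var {x}) dbs         refl | tri< _ _ _ = var , dbs
  rsub-sound k (var {x}) []          ()   | tri≈ _ _ _
  rsub-sound k (var {x}) (dq ∷ dbs)  refl | tri≈ _ _ _ = shiftN-∈T k dq , dbs
  rsub-sound k (var {x}) dbs         refl | tri> _ _ _ = var , dbs
  rsub-sound k {rlam p} {bs = bs} (lam d) dbs e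
    with >>=-just-inv (rsub (suc k) p bs) _ e
  ... | _ , e₁ , refl with rsub-sound (suc k) d dbs e₁
  ...   | db , drest = lam db , drest
  rsub-sound k {rapp p ps} {bs = bs} (app d ds) dbs e
    with >>=-just-inv (rsub k p bs) _ e
  ... | (_ , bs₁) , e₁ , e₂ with >>=-just-inv (rsubs k ps bs₁) _ e₂
  ...   | _ , e₃ , refl with rsub-sound k d dbs e₁
  ...     | db , dbs₁ with rsubs-sound k ds dbs₁ e₃
  ...       | dds , dbs₂ = app db dds , dbs₂

  rsubs-sound : ∀ k {ps P Q bs ds rest} → All (_∈T P) ps → All (_∈T Q) bs →
    rsubs k ps bs ≡ just (ds , rest) → All (_∈T subst k P Q) ds × All (_∈T Q) rest
  rsubs-sound k [] dbs refl = [] , dbs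
  rsubs-sound k {p ∷ ps} {bs = bs} (d ∷ dps) dbs e
    with >>=-just-inv (rsub k p bs) _ e
  ... | (_ , bs₁) , e₁ , e₂ with >>=-just-inv (rsubs k ps bs₁) _ e₂
  ...   | _ , e₃ , refl with rsub-sound k d dbs e₁
  ...     | db , dbs₁ with rsubs-sound k dps dbs₁ e₃
  ...       | dds , dbs₂ = db ∷ dds , dbs₂

-- b is obtained from an approximant p of P by substituting for index k a
-- list bs of approximants of Q whose length is the number of occurrences of
-- k in p; rsub consumes exactly bs and hands any further arguments back.
SubstDecomposition : ℕ → Λ → Λ → RT → Set
SubstDecomposition k P Q b = ∃ λ p → ∃ λ bs → p ∈T P × All (_∈T Q) bs ×
  (∀ rest → rsub k p (bs ++ rest) ≡ just (b , rest)) × occ k p ≡ length bs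

SubstDecompositions : ℕ → Λ → Λ → List RT → Set
SubstDecompositions k P Q ds = ∃ λ ps → ∃ λ bs → All (_∈T P) ps × All (_∈T Q) bs ×
  (∀ rest → rsubs k ps (bs ++ rest) ≡ just (ds , rest)) × occs k ps ≡ length bs

-- The variable case; its type is spelled out (rather than using
-- SubstDecomposition) so that the comparison of x with k is abstracted in it.
rsub-complete-var : ∀ k x Q {b} → b ∈T subst k (var x) Q → ∃ λ bs → All (_∈T Q) bs ×
  (∀ rest → rsub k (rvar x) (bs ++ rest) ≡ just (b , rest)) × occ k (rvar x) ≡ length bs
rsub-complete-var k x Q d with <-cmp x k
rsub-complete-var k x Q var | tri< _ x≢k _ rewrite ≢⇒≡ᵇ-false x k x≢k =
  [] , [] , (λ rest → refl) , refl
rsub-complete-var k x Q d   | tri≈ _ refl _ with shiftN-∈T-inv k Q d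
... | q , dq , refl rewrite ≡ᵇ-refl x = q ∷ [] , dq ∷ [] , (λ rest → refl) , refl
rsub-complete-var k x Q var | tri> _ x≢k _ rewrite ≢⇒≡ᵇ-false x k x≢k =
  [] , [] , (λ rest → refl) , refl

-- Substitution lemma, completeness: every approximant of P[Q/k] decomposes.
-- At an application the argument lists of the two sides are concatenated.
mutual
  rsub-complete : ∀ k P Q {b} → b ∈T subst k P Q → SubstDecomposition k P Q b
  rsub-complete k (var x) Q d with rsub-complete-var k x Q d
  ... | bs , dbs , run , count = rvar x , bs , var , dbs , run , count
  rsub-complete k (lam P) Q (lam d) with rsub-complete (suc k) P Q d
  ... | p , bs , dp , dbs , run , count =
    rlam p , bs , lam dp , dbs , (λ rest → cong (_>>= _) (run rest)) , count
  rsub-complete k (app P P′) Q (app d ds)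
    with rsub-complete k P Q d | rsubs-complete k P′ Q ds
  ... | p , bs₁ , dp , dbs₁ , run₁ , count₁ | ps , bs₂ , dps , dbs₂ , run₂ , count₂ =
    rapp p ps , bs₁ ++ bs₂ , app dp dps , ++⁺ dbs₁ dbs₂ , run ,
    trans (cong₂ _+_ count₁ count₂) (sym (length-++ bs₁))
    where
    run : ∀ rest → rsub k (rapp p ps) ((bs₁ ++ bs₂) ++ rest) ≡ just (_ , rest)
    run rest rewrite ++-assoc bs₁ bs₂ rest | run₁ (bs₂ ++ rest) | run₂ rest = refl

  rsubs-complete : ∀ k P Q {ds} → All (_∈T subst k P Q) ds → SubstDecompositions k P Q ds
  rsubs-complete k P Q []       = [] , [] , [] , [] , (λ rest → refl) , refl
  rsubs-complete k P Q (d ∷ ds) with rsub-complete k P Q d | rsubs-complete k P Q ds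
  ... | p , bs₁ , dp , dbs₁ , run₁ , count₁ | ps , bs₂ , dps , dbs₂ , run₂ , count₂ =
    p ∷ ps , bs₁ ++ bs₂ , dp ∷ dps , ++⁺ dbs₁ dbs₂ , run ,
    trans (cong₂ _+_ count₁ count₂) (sym (length-++ bs₁))
    where
    run : ∀ rest → rsubs k (p ∷ ps) ((bs₁ ++ bs₂) ++ rest) ≡ just (_ , rest)
    run rest rewrite ++-assoc bs₁ bs₂ rest | run₁ (bs₂ ++ rest) | run₂ rest = refl

rsubst-sound : ∀ {p P Q ds b} → p ∈T P → All (_∈T Q) ds → rsubst p ds ≡ just b →
  b ∈T (P [ Q ])
rsubst-sound {p} {ds = ds} dp dds e with occ 0 p ≡ᵇ length ds
... | true with map-just-inv proj₁ (rsub 0 p ds) e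
...   | _ , e₁ , refl = proj₁ (rsub-sound 0 dp dds e₁)
rsubst-sound dp dds () | false

rsubst-complete : ∀ P Q {b} → b ∈T (P [ Q ]) →
  ∃ λ p → ∃ λ ds → p ∈T P × All (_∈T Q) ds × rsubst p ds ≡ just b
rsubst-complete P Q d with rsub-complete 0 P Q d
... | p , bs , dp , dbs , run , count = p , bs , dp , dbs , computes
  where
  run-exact : rsub 0 p bs ≡ just (_ , [])
  run-exact = Eq.subst (λ l → rsub 0 p l ≡ just (_ , [])) (++-identityʳ bs) (run [])

  computes : rsubst p bs ≡ just _
  computes = trans (if-true (trans (cong (_≡ᵇ length bs) count) (≡ᵇ-refl (length bs))))
                   (cong (Maybe.map proj₁) run-exact)

mutual
  Lr-sound : ∀ {a M b} → a ∈T M → Lr a ≡ just b → b ∈T L M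
  Lr-sound {a} {M} d e rewrite L≡L₀ M | Lr≡Lr₀ a = Lr₀-sound d e

  Lr₀-sound : ∀ {a M b} → a ∈T M → Lr₀ a ≡ just b → b ∈T L₀ M
  Lr₀-sound var refl = var
  Lr₀-sound {rlam a} (lam d) e with map-just-inv rlam (Lr₀ a) e
  ... | _ , e₁ , refl = lam (Lr₀-sound d e₁)
  Lr₀-sound (app (lam d) ds) e = rsubst-sound d ds e
  Lr₀-sound {rapp (rvar x) ds} (app var dds) e with >>=-just-inv (Lrs ds) _ e
  ... | _ , e₁ , refl = app var (Lrs-sound dds e₁)
  Lr₀-sound {rapp (rapp c ds₁) ds} (app {P = app P₁ P₂} (app d dds₁) dds) e
    rewrite headVar-∈T d with headVar P₁
  ... | true with >>=-just-inv (argsLr (rapp c ds₁)) _ e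
  ...   | _ , e₁ , e₂ with >>=-just-inv (Lrs ds) _ e₂
  ...     | _ , e₃ , refl = app (argsLr-sound (app d dds₁) e₁) (Lrs-sound dds e₃)
  Lr₀-sound {rapp (rapp c ds₁) ds} (app {P = app P₁ P₂} (app d dds₁) dds) e
    | false with >>=-just-inv (Lr₀ (rapp c ds₁)) _ e
  ...   | _ , e₁ , refl = app (Lr₀-sound (app d dds₁) e₁) dds

  argsLr-sound : ∀ {c M c′} → c ∈T M → argsLr c ≡ just c′ → c′ ∈T argsL M
  argsLr-sound var     refl = var
  argsLr-sound (lam d) refl = lam d
  argsLr-sound {rapp c ds} (app d dds) e with >>=-just-inv (argsLr c) _ e
  ... | _ , e₁ , e₂ with >>=-just-inv (Lrs ds) _ e₂
  ...   | _ , e₃ , refl = app (argsLr-sound d e₁) (Lrs-sound dds e₃)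

  Lrs-sound : ∀ {ds N ds′} → All (_∈T N) ds → Lrs ds ≡ just ds′ → All (_∈T L N) ds′
  Lrs-sound [] refl = []
  Lrs-sound {d ∷ ds} (dd ∷ dds) e with >>=-just-inv (Lr d) _ e
  ... | _ , e₁ , e₂ with >>=-just-inv (Lrs ds) _ e₂
  ...   | _ , e₃ , refl = Lr-sound dd e₁ ∷ Lrs-sound dds e₃

mutual
  Lr-complete : ∀ M {b} → b ∈T L M → ∃ λ a → a ∈T M × Lr a ≡ just b
  Lr-complete M d rewrite L≡L₀ M with Lr₀-complete M d
  ... | a , da , e = a , da , trans (Lr≡Lr₀ a) e

  Lr₀-complete : ∀ M {b} → b ∈T L₀ M → ∃ λ a → a ∈T M × Lr₀ a ≡ just b
  Lr₀-complete (var x) var = rvar x , var , refl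
  Lr₀-complete (lam M) (lam d) with Lr₀-complete M d
  ... | a , da , e = rlam a , lam da , cong (Maybe.map rlam) e
  Lr₀-complete (app (lam P) Q) d with rsubst-complete P Q d
  ... | p , ds , dp , dds , e = rapp (rlam p) ds , app (lam dp) dds , e
  Lr₀-complete (app (var x) N) (app var dds) with Lrs-complete N dds
  ... | ds , dds′ , e = rapp (rvar x) ds , app var dds′ , cong (_>>= _) e
  Lr₀-complete (app (app P₁ P₂) N) d with headVar P₁ in head
  Lr₀-complete (app (app P₁ P₂) N) (app dc dds) | true
    with argsLr-complete (app P₁ P₂) dc | Lrs-complete N dds
  ... | rapp c ds₁ , app dc₁ dds₁ , e₁ | ds , dds′ , e₂ =
    rapp (rapp c ds₁) ds , app (app dc₁ dds₁) dds′ ,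
    trans (if-true (trans (headVar-∈T dc₁) head)) (>>=₂-just rapp e₁ e₂)
  Lr₀-complete (app (app P₁ P₂) N) (app dc dds) | false
    with Lr₀-complete (app P₁ P₂) dc
  ... | rapp c ds₁ , app dc₁ dds₁ , e₁ =
    rapp (rapp c ds₁) _ , app (app dc₁ dds₁) dds ,
    trans (if-false (trans (headVar-∈T dc₁) head)) (cong (_>>= _) e₁)

  argsLr-complete : ∀ M {c′} → c′ ∈T argsL M → ∃ λ c → c ∈T M × argsLr c ≡ just c′
  argsLr-complete (var x)   var     = rvar x , var , refl
  argsLr-complete (lam M)   (lam d) = _ , lam d , refl
  argsLr-complete (app M N) (app dc dds) with argsLr-complete M dc | Lrs-complete N dds
  ... | c , dc′ , e₁ | ds , dds′ , e₂ = rapp c ds , app dc′ dds′ , >>=₂-just rapp e₁ e₂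

  Lrs-complete : ∀ N {ds′} → All (_∈T L N) ds′ → ∃ λ ds → All (_∈T N) ds × Lrs ds ≡ just ds′
  Lrs-complete N []         = [] , [] , refl
  Lrs-complete N (d ∷ dds) with Lr-complete N d | Lrs-complete N dds
  ... | a , da , e₁ | ds , dds′ , e₂ = a ∷ ds , da ∷ dds′ , >>=₂-just _∷_ e₁ e₂

mainTheorem13 : (M : Λ) (b : RT) →
    (∃ λ a → a ∈T M × Lr a ≡ just b) ⇔ (b ∈T L M)
mainTheorem13 M b = mk⇔ (λ { (a , da , e) → Lr-sound da e }) (Lr-complete M)
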